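{- Let $(\mathcal N,s_0)$ be a marked RPN with $s_0=s[r,m_0]$ a single-vertex state. Then there exists a deep infinite firing sequence starting from $s_0$ if and only if the abstract graph $G_{\mathcal N,s_0}$ contains a cycle.
   Context: A Recursive Petri Net (RPN) is a tuple $\mathcal N=\langle P,T,W^+,W^-,\Omega\rangle$ where $P$ is a finite set of places, $T=T_{el}\uplus T_{ab}\uplus T_{\tau}$ is a finite set of transitions disjoint from $P$ (elementary, abstract and cut transitions), $W^-\in\mathbb N^{P\times T}$, $W^+\in\mathbb N^{P\times(T_{el}\uplus T_{ab})}$, and $\Omega:T_{ab}\to\mathbb N^P$. Write $W^{\pm}(t)\in\mathbb N^P$ for the column of $t$; markings are compared componentwise. A (concrete) state is either the empty tree $\emptyset$ or a finite rooted tree whose vertices (threads) are taken from a fixed countably infinite set $\mathcal V$, each vertex $v$ labelled by a marking $M_s(v)\in\mathbb N^P$ and each edge labelled by a vector in $\{W^+(t):t\in T_{ab}\}$. Firing rule: a thread $v$ of a state $s\neq\emptyset$ can fire $t$ if $W^-(t)\le M_s(v)$, giving $s\xrightarrow{(v,t)}s'$ where: if $t\in T_{el}$, the marking of $v$ becomes $M_s(v)-W^-(t)+W^+(t)$; if $t\in T_{ab}$, the marking of $v$ becomes $M_s(v)-W^-(t)$ and a new child $w$ of $v$ (a vertex never used before) is created with marking $\Omega(t)$ and edge $v\to w$ labelled $W^+(t)$; if $t\in T_\tau$, the subtree rooted at $v$ is deleted, and if $v$ is the root the result is $\emptyset$, otherwise the marking of the parent $u$ of $v$ is increased by the label of the edge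 $u\to v$. $s[r,m]$ is the state with a single vertex $r$ marked $m$. The depth of a state is the maximal number of edges on a path from its root. An infinite firing sequence is deep if it visits a state of depth strictly greater than $|T_{ab}|$. The abstract graph $G_{\mathcal N,s_0}=(V_a,E_a,M_a)$ is the smallest labelled directed graph with vertex set contained in $\{r\}\cup\{v_t\mid t\in T_{ab}\}$ such that $r\in V_a$ with $M_a(r)=m_0$, and for every $v\in V_a$ and $t\in T_{ab}$, if there is a finite firing sequence $\sigma$ from $s[v,M_a(v)]$ after which the root $v$ can fire $t$ (i.e. $s[v,M_a(v)]\xrightarrow{\sigma(v,t)}$), then $v_t\in V_a$, $(v,v_t)\in E_a$ and $M_a(v_t)=\Omega(t)$. -}

module Defs where

open import Data.Nat using (ℕ; zero; suc; _+_; _∸_; _≤_; _<_; _⊔_)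
open import Data.Fin using (Fin)
open import Data.List using (List; []; _∷_; _++_)
open import Data.Maybe using (Maybe; just; nothing)
open import Data.Product using (Σ; _×_; _,_; ∃)
open import Relation.Binary.PropositionalEquality using (_≡_)
open import Relation.Binary.Construct.Closure.ReflexiveTransitive using (Star)
open import Relation.Binary.Construct.Closure.Transitive using (TransClosure)

Marking : ℕ → Set
Marking np = Fin np → ℕ

_≤ₘ_ : ∀ {np} → Marking np → Marking np → Set
a ≤ₘ b = ∀ p → a p ≤ b p

_+ₘ_ : ∀ {np} → Marking np → Marking np → Marking np
(a +ₘ b) p = a p + b p

_∸ₘ_ : ∀ {np} → Marking np → Marking np → Marking np
(a ∸ₘ b) p = a p ∸ b p

-- Recursive Petri nets.  T = T_el ⊎ T_ab ⊎ T_τ with |T_el| = ne,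
-- |T_ab| = na, |T_τ| = nc.

data Tran (ne na nc : ℕ) : Set where
  el  : Fin ne → Tran ne na nc
  ab  : Fin na → Tran ne na nc
  cut : Fin nc → Tran ne na nc

record RPN : Set where
  field
    np ne na nc : ℕ
    W⁻    : Tran ne na nc → Marking np
    W⁺el  : Fin ne → Marking np
    W⁺ab  : Fin na → Marking np
    Ω     : Fin na → Marking np

module _ (N : RPN) where
  open RPN N

  T : Set
  T = Tran ne na nc

  -- Non-empty states: finite rooted trees, each vertex labelled by a
  -- marking, each edge (to a child) labelled by a vector in ℕ^P.
  -- Vertices are identified by their position in the tree (threads
  -- are anonymous).
  data Tree : Set where
    node : Marking np → List (Marking np × Tree) → Tree

  State : Set
  State = Maybe Tree

  single : Marking np → State
  single m = just (node m [])

  depthT : Tree → ℕ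
  depthL : List (Marking np × Tree) → ℕ
  depthT (node m cs) = depthL cs
  depthL [] = 0
  depthL ((l , c) ∷ cs) = suc (depthT c) ⊔ depthL cs

  depth : State → ℕ
  depth nothing = 0
  depth (just τ) = depthT τ

  data Result : Set where
    kept : Tree → Result
    cutR : Result

  data FireT : Tree → T → Result → Set
  data FireC : Marking np → List (Marking np × Tree) → T →
               Marking np → List (Marking np × Tree) → Set

  data FireT where
    fire-el  : ∀ {m cs t} → W⁻ (el t) ≤ₘ m →
               FireT (node m cs) (el t)
                     (kept (node ((m ∸ₘ W⁻ (el t)) +ₘ W⁺el t) cs))
    fire-ab  : ∀ {m cs t} → W⁻ (ab t) ≤ₘ m →
               FireT (node m cs) (ab t)
                     (kept (node (m ∸ₘ W⁻ (ab t))
                                 (cs ++ ((W⁺ab t , node (Ω t) []) ∷ []))))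
    fire-cut : ∀ {m cs t} → W⁻ (cut t) ≤ₘ m →
               FireT (node m cs) (cut t) cutR
    inside   : ∀ {m cs t m' cs'} → FireC m cs t m' cs' →
               FireT (node m cs) t (kept (node m' cs'))

  data FireC where
    child-kept : ∀ {m l c cs t c'} → FireT c t (kept c') →
                 FireC m ((l , c) ∷ cs) t m ((l , c') ∷ cs)
    child-cut  : ∀ {m l c cs t} → FireT c t cutR →
                 FireC m ((l , c) ∷ cs) t (m +ₘ l) cs
    later      : ∀ {m x cs t m' cs'} → FireC m cs t m' cs' →
                 FireC m (x ∷ cs) t m' (x ∷ cs')

  data Step : State → State → Set where
    step-kept : ∀ {τ t τ'} → FireT τ t (kept τ') → Step (just τ) (just τ')
    step-cut  : ∀ {τ t} → FireT τ t cutR → Step (just τ) nothing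

  record InfSeq (s₀ : State) : Set where
    field
      states : ℕ → State
      start  : states 0 ≡ s₀
      steps  : ∀ n → Step (states n) (states (suc n))

  DeepInfSeq : State → Set
  DeepInfSeq s₀ = Σ (InfSeq s₀) λ σ → ∃ λ n → na < depth (InfSeq.states σ n)

  data AVertex : Set where
    r  : AVertex
    v_ : Fin na → AVertex

  module _ (m₀ : Marking np) where

    Mₐ : AVertex → Marking np
    Mₐ r = m₀
    Mₐ (v t) = Ω t

    RootCanFireAfter : Marking np → Fin na → Set
    RootCanFireAfter m t =
      ∃ λ m' → ∃ λ cs → Star Step (single m) (just (node m' cs))
                         × W⁻ (ab t) ≤ₘ m'

    data Vₐ : AVertex → Set where
      root∈ : Vₐ r
      new∈  : ∀ {u t} → Vₐ u → RootCanFireAfter (Mₐ u) t → Vₐ (v t)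

    data Eₐ : AVertex → AVertex → Set where
      edge : ∀ {u t} → Vₐ u → RootCanFireAfter (Mₐ u) t → Eₐ u (v t)

    HasCycle : Set
    HasCycle = ∃ λ u → TransClosure Eₐ u u

-- Deep ⇒ cycle: along any run from s₀, every thread of depth d lies over a
-- walk of length d in the abstract graph, because each of its ancestors was
-- created by an abstract transition fired after a finite run of the thread
-- above it.  A state of depth > |T_ab| therefore yields a walk visiting more
-- than |V_a| vertices, and the pigeonhole principle closes a cycle.
--
-- Cycle ⇒ deep: a path in the abstract graph is realised by a run from a
-- single thread that pushes a new thread below it at each edge.  Since a run
-- of a subtree can be replayed inside any context, the run around a cycle at
-- u can be repeated at the newest thread forever, and the depth grows without
-- bound.

module Submission where

open import Defs
open import Function.Bundles using (_⇔_; mk⇔)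
open import Function.Definitions using (Injective)
open import Data.Nat using (ℕ; zero; suc; _+_; _≤_; _<_; z≤n; s≤s)
open import Data.Nat.Properties
  using (≤-trans; ≤-pred; n<1+n; n≤1+n; m≤m⊔n; m≤n⊔m; m≤m+n; m≤n+m; ⊔-sel;
         m≤n⇒m<n∨m≡n; +-mono-≤; +-comm)
open import Data.Fin using (Fin; toℕ) renaming (zero to fzero; suc to fsuc)
open import Data.Fin.Properties using (pigeonhole; toℕ<n)
open import Data.List using (List; []; _∷_; _++_)
open import Data.List.Relation.Unary.All using (All; []; _∷_)
import Data.List.Relation.Unary.All.Properties as All
open import Data.Maybe using (just; nothing)
open import Data.Product using (Σ; _×_; _,_; ∃; proj₁; proj₂)
open import Data.Sum using (inj₁; inj₂)
open import Data.Unit using (⊤; tt)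
open import Relation.Binary.PropositionalEquality
  using (_≡_; refl; sym; trans; cong; subst)
open import Relation.Binary.Construct.Closure.ReflexiveTransitive
  using (Star; ε; _◅_; _◅◅_)
open import Relation.Binary.Construct.Closure.Transitive
  using (TransClosure; [_]; _∷_; _∷ʳ_) renaming (_++_ to _++⁺_)

Walk : {A : Set} → (A → A → Set) → A → ℕ → Set
Walk {A} R u k = Σ (ℕ → A) λ w → w 0 ≡ u × (∀ i → i < k → R (w i) (w (suc i)))

module _ {A : Set} {R : A → A → Set} where

  infixr 5 _◅◅⁺_

  _◅◅⁺_ : ∀ {x y z} → Star R x y → TransClosure R y z → TransClosure R x z
  ε ◅◅⁺ q = q
  (e ◅ ρ) ◅◅⁺ q = e ∷ (ρ ◅◅⁺ q)

  TransClosure⇒Star : ∀ {x y} → TransClosure R x y → Star R x y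
  TransClosure⇒Star [ e ] = e ◅ ε
  TransClosure⇒Star (e ∷ q) = e ◅ TransClosure⇒Star q

  walk-∷ : ∀ {u x k} → R u x → Walk R x k → Walk R u (suc k)
  walk-∷ {u} e (w , refl , es) = w′ , refl , es′
    where
      w′ : ℕ → A
      w′ zero = u
      w′ (suc i) = w i
      es′ : ∀ i → i < suc _ → R (w′ i) (w′ (suc i))
      es′ zero _ = e
      es′ (suc i) (s≤s i<k) = es i i<k

  walk-segment : ∀ (w : ℕ → A) {k} → (∀ i → i < k → R (w i) (w (suc i))) →
                 ∀ {i j} → i < j → j ≤ k → TransClosure R (w i) (w j)
  walk-segment w es {i} {suc j} (s≤s i≤j) j<k with m≤n⇒m<n∨m≡n i≤j
  ... | inj₂ refl = [ es i j<k ]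
  ... | inj₁ i<j = walk-segment w es i<j (≤-trans (n≤1+n j) j<k) ∷ʳ es j j<k

  walk⇒cycle : ∀ {n u} (code : A → Fin n) → Injective _≡_ _≡_ code →
               Walk R u n → ∃ λ x → TransClosure R x x
  walk⇒cycle {n} code code-injective (w , _ , es)
    with i , j , i<j , same ← pigeonhole (n<1+n n) (λ i → code (w (toℕ i)))
    = w (toℕ i) , subst (TransClosure R (w (toℕ i))) (sym (code-injective same))
                        (walk-segment w es i<j (≤-pred (toℕ<n j)))

map⁺ : ∀ {A B : Set} {R : A → A → Set} {S : B → B → Set} {f : A → B} →
       (∀ {x y} → R x y → S (f x) (f y)) →
       ∀ {x y} → TransClosure R x y → TransClosure S (f x) (f y)
map⁺ g [ e ] = [ g e ]
map⁺ g (e ∷ q) = g e ∷ map⁺ g q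

module Concatenation {A : Set} {R : A → A → Set} (a : ℕ → A)
                     (hop : ∀ k → TransClosure R (a k) (a (suc k))) where

  record Position : Set where
    constructor at
    field
      segment : ℕ
      here    : A
      rest    : TransClosure R here (a (suc segment))
  open Position

  start : ℕ → Position
  start k = at k (a k) (hop k)

  next : Position → Position
  next (at k _ [ _ ]) = start (suc k)
  next (at k _ (_ ∷ q)) = at k _ q

  advance : ℕ → Position → Position
  advance zero p = p
  advance (suc n) p = advance n (next p)

  advance-+ : ∀ n j p → advance (n + j) p ≡ advance j (advance n p)
  advance-+ zero j p = refl
  advance-+ (suc n) j p = advance-+ n j (next p)

  advance-step : ∀ n p → R (here (advance n p)) (here (advance (suc n) p))
  advance-step zero (at _ _ [ e ]) = e
  advance-step zero (at _ _ (e ∷ _)) = e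
  advance-step (suc n) p = advance-step n (next p)

  finish-segment : ∀ k {x} (q : TransClosure R x (a (suc k))) →
                   ∃ λ j → advance j (at k x q) ≡ start (suc k)
  finish-segment k [ _ ] = 1 , refl
  finish-segment k (_ ∷ q) with j , eq ← finish-segment k q = suc j , eq

  reach-start : ∀ k → ∃ λ n → advance n (start 0) ≡ start k
  reach-start zero = 0 , refl
  reach-start (suc k)
    with n , eqₙ ← reach-start k
       | j , eqⱼ ← finish-segment k (hop k)
    = n + j , trans (advance-+ n j (start 0))
                    (trans (cong (advance j) eqₙ) eqⱼ)

  path : ℕ → A
  path n = here (advance n (start 0))

  path-step : ∀ n → R (path n) (path (suc n))
  path-step n = advance-step n (start 0)

  path-visits : ∀ k → ∃ λ n → path n ≡ a k
  path-visits k with n , eq ← reach-start k = n , cong here eq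

module _ (N : RPN) where
  open RPN N

  _↝_ : Tree N → Tree N → Set
  τ ↝ τ′ = ∃ λ t → FireT N τ t (kept τ′)

  ↝⇒Step : ∀ {τ τ′} → τ ↝ τ′ → Step N (just τ) (just τ′)
  ↝⇒Step (_ , f) = step-kept f

  Star-Step⇒↝ : ∀ {τ τ′} → Star (Step N) (just τ) (just τ′) → Star _↝_ τ τ′
  Star-Step⇒↝ ε = ε
  Star-Step⇒↝ (step-kept f ◅ ρ) = (_ , f) ◅ Star-Step⇒↝ ρ
  Star-Step⇒↝ (step-cut _ ◅ () ◅ _)

  ↝-run⇒InfSeq : (f : ℕ → Tree N) → (∀ n → f n ↝ f (suc n)) → InfSeq N (just (f 0))
  ↝-run⇒InfSeq f steps = record
    { states = λ n → just (f n) ; start = refl ; steps = λ n → ↝⇒Step (steps n) }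

  deep-child : ∀ {P : Marking np × Tree N → Set} {cs k} → All P cs →
               suc k ≤ depthL N cs → ∃ λ lc → P lc × k ≤ depthT N (proj₂ lc)
  deep-child {cs = (l , c) ∷ cs} (p ∷ ps) deep with ⊔-sel (suc (depthT N c)) (depthL N cs)
  ... | inj₁ eq = (l , c) , p , ≤-pred (subst (_ ≤_) eq deep)
  ... | inj₂ eq = deep-child ps (subst (_ ≤_) eq deep)

  -- The hole sits in the last child: that is where firing an abstract
  -- transition puts the new thread.
  data Context : Set where
    hole      : Context
    lastChild : Marking np → List (Marking np × Tree N) → Marking np →
                Context → Context

  plug : Context → Tree N → Tree N
  plug hole τ = τ
  plug (lastChild m cs l C) τ = node m (cs ++ (l , plug C τ) ∷ [])

  _⊙_ : Context → Context → Context
  hole ⊙ C′ = C′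
  lastChild m cs l C ⊙ C′ = lastChild m cs l (C ⊙ C′)

  plug-⊙ : ∀ C C′ τ → plug (C ⊙ C′) τ ≡ plug C (plug C′ τ)
  plug-⊙ hole C′ τ = refl
  plug-⊙ (lastChild m cs l C) C′ τ =
    cong (λ τ′ → node m (cs ++ (l , τ′) ∷ [])) (plug-⊙ C C′ τ)

  height : Context → ℕ
  height hole = 0
  height (lastChild _ _ _ C) = suc (height C)

  height-⊙ : ∀ C C′ → height (C ⊙ C′) ≡ height C + height C′
  height-⊙ hole C′ = refl
  height-⊙ (lastChild _ _ _ C) C′ = cong suc (height-⊙ C C′)

  depthL-++-last : ∀ cs l c → suc (depthT N c) ≤ depthL N (cs ++ (l , c) ∷ [])
  depthL-++-last [] l c = m≤m⊔n (suc (depthT N c)) 0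
  depthL-++-last (_ ∷ cs) l c = ≤-trans (depthL-++-last cs l c) (m≤n⊔m _ _)

  height≤depth-plug : ∀ C τ → height C ≤ depthT N (plug C τ)
  height≤depth-plug hole τ = z≤n
  height≤depth-plug (lastChild m cs l C) τ =
    ≤-trans (s≤s (height≤depth-plug C τ)) (depthL-++-last cs l (plug C τ))

  fireC-last : ∀ {m l c t c′} cs → FireT N c t (kept c′) →
               FireC N m (cs ++ (l , c) ∷ []) t m (cs ++ (l , c′) ∷ [])
  fireC-last [] f = child-kept f
  fireC-last (_ ∷ cs) f = later (fireC-last cs f)

  ↝-plug : ∀ C {τ τ′} → τ ↝ τ′ → plug C τ ↝ plug C τ′
  ↝-plug hole f = f
  ↝-plug (lastChild m cs l C) f with t , g ← ↝-plug C f = t , inside (fireC-last cs g)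

  run-⊙ : ∀ C {τ C′ τ′} → TransClosure _↝_ τ (plug C′ τ′) →
          TransClosure _↝_ (plug C τ) (plug (C ⊙ C′) τ′)
  run-⊙ C {C′ = C′} {τ′} ρ rewrite plug-⊙ C C′ τ′ = map⁺ (↝-plug C) ρ

  AVertex-code : AVertex N → Fin (suc na)
  AVertex-code r = fzero
  AVertex-code (v t) = fsuc t

  AVertex-code-injective : Injective _≡_ _≡_ AVertex-code
  AVertex-code-injective {r} {r} _ = refl
  AVertex-code-injective {v _} {v _} refl = refl

  module _ (m₀ : Marking np) where

    E : AVertex N → AVertex N → Set
    E = Eₐ N m₀

    data Over (u : AVertex N) : Tree N → Set

    ChildOver : AVertex N → Marking np × Tree N → Set
    ChildOver u (_ , c) = ∃ λ t → E u (v t) × Over (v t) c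

    data Over u where
      over : ∀ {m cs} → Vₐ N m₀ u →
             Star (Step N) (single N (Mₐ N m₀ u)) (just (node m cs)) →
             All (ChildOver u) cs → Over u (node m cs)

    Over-fire : ∀ {u τ t τ′} → Over u τ → FireT N τ t (kept τ′) → Over u τ′
    ChildOver-fireC : ∀ {u m cs t m′ cs′} → All (ChildOver u) cs →
                      FireC N m cs t m′ cs′ → All (ChildOver u) cs′

    Over-fire (over vu ρ cs) f@(fire-el _) = over vu (ρ ◅◅ step-kept f ◅ ε) cs
    Over-fire (over vu ρ cs) f@(fire-ab {t = t} le) =
      over vu (ρ ◅◅ step-kept f ◅ ε)
           (All.++⁺ cs ((t , edge vu can-fire , over (new∈ vu can-fire) ε []) ∷ []))
      where
        can-fire : RootCanFireAfter N m₀ _ t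
        can-fire = _ , _ , ρ , le
    Over-fire (over vu ρ cs) f@(inside g) =
      over vu (ρ ◅◅ step-kept f ◅ ε) (ChildOver-fireC cs g)

    ChildOver-fireC ((t , e , o) ∷ cs) (child-kept f) = (t , e , Over-fire o f) ∷ cs
    ChildOver-fireC (_ ∷ cs) (child-cut _) = cs
    ChildOver-fireC (c ∷ cs) (later g) = c ∷ ChildOver-fireC cs g

    OverState : State N → Set
    OverState nothing = ⊤
    OverState (just τ) = Over r τ

    Step-preserves-OverState : ∀ {s s′} → OverState s → Step N s s′ → OverState s′
    Step-preserves-OverState o (step-kept f) = Over-fire o f
    Step-preserves-OverState _ (step-cut _) = tt

    InfSeq-OverState : (σ : InfSeq N (single N m₀)) → ∀ n → OverState (InfSeq.states σ n)
    InfSeq-OverState σ zero rewrite InfSeq.start σ = over root∈ ε []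
    InfSeq-OverState σ (suc n) =
      Step-preserves-OverState (InfSeq-OverState σ n) (InfSeq.steps σ n)

    Over-walk : ∀ {u τ k} → Over u τ → k ≤ depthT N τ → Walk E u k
    Over-walk {u} {k = zero} _ _ = (λ _ → u) , refl , λ _ ()
    Over-walk {k = suc k} (over _ _ cs) deep
      with (_ , _) , (_ , e , o) , deep′ ← deep-child cs deep
      = walk-∷ {R = E} e (Over-walk o deep′)

    deep-OverState⇒cycle : ∀ s → OverState s → na < depth N s → HasCycle N m₀
    deep-OverState⇒cycle (just τ) o deep =
      walk⇒cycle AVertex-code AVertex-code-injective (Over-walk o deep)

    deep⇒cycle : DeepInfSeq N (single N m₀) → HasCycle N m₀
    deep⇒cycle (σ , n , deep) =
      deep-OverState⇒cycle (InfSeq.states σ n) (InfSeq-OverState σ n) deep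

    leaf : AVertex N → Tree N
    leaf x = node (Mₐ N m₀ x) []

    record Descends* (x y : AVertex N) : Set where
      constructor descends*
      field
        context : Context
        run     : Star _↝_ (leaf x) (plug context (leaf y))

    record Descends⁺ (x y : AVertex N) : Set where
      constructor descends⁺
      field
        context : Context
        deeper  : 1 ≤ height context
        run     : TransClosure _↝_ (leaf x) (plug context (leaf y))

    edge-descends : ∀ {x y} → E x y → Descends⁺ x y
    edge-descends (edge {t = t} _ (m , cs , ρ , le)) =
      descends⁺ (lastChild (m ∸ₘ W⁻ (ab t)) cs (W⁺ab t) hole) (s≤s z≤n)
                (Star-Step⇒↝ ρ ◅◅⁺ [ ab t , fire-ab le ])

    descends-trans : ∀ {x y z} → Descends⁺ x y → Descends⁺ y z → Descends⁺ x z
    descends-trans (descends⁺ C h ρ) (descends⁺ C′ _ ρ′) =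
      descends⁺ (C ⊙ C′) (subst (1 ≤_) (sym (height-⊙ C C′)) (≤-trans h (m≤m+n _ _)))
                (ρ ++⁺ run-⊙ C ρ′)

    path-descends : ∀ {x y} → TransClosure E x y → Descends⁺ x y
    path-descends [ e ] = edge-descends e
    path-descends (e ∷ p) = descends-trans (edge-descends e) (path-descends p)

    reachable-descends : ∀ {u} → Vₐ N m₀ u → Descends* r u
    reachable-descends root∈ = descends* hole ε
    reachable-descends (new∈ vu can)
      with descends* C ρ ← reachable-descends vu
         | descends⁺ C′ _ ρ′ ← edge-descends (edge vu can)
      = descends* (C ⊙ C′) (ρ ◅◅ TransClosure⇒Star (run-⊙ C ρ′))

    pump⇒deep : ∀ {u} → Descends* r u → Descends⁺ u u → DeepInfSeq N (single N m₀)
    pump⇒deep {u} (descends* C₀ ρ₀) (descends⁺ C 1≤h ρ) =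
      ↝-run⇒InfSeq path path-step , n , subst (λ τ → na < depthT N τ) (sym visit) deep
      where
        pumped : ℕ → Context
        pumped zero = C₀ ⊙ C
        pumped (suc k) = pumped k ⊙ C

        height-pumped : ∀ k → suc k ≤ height (pumped k)
        height-pumped zero rewrite height-⊙ C₀ C = ≤-trans 1≤h (m≤n+m _ _)
        height-pumped (suc k)
          rewrite height-⊙ (pumped k) C | +-comm (height (pumped k)) (height C)
          = +-mono-≤ 1≤h (height-pumped k)

        a : ℕ → Tree N
        a zero = leaf r
        a (suc k) = plug (pumped k) (leaf u)

        hop : ∀ k → TransClosure _↝_ (a k) (a (suc k))
        hop zero = ρ₀ ◅◅⁺ run-⊙ C₀ ρ
        hop (suc k) = run-⊙ (pumped k) ρ

        open Concatenation a hop

        n : ℕ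
        n = proj₁ (path-visits (suc na))

        visit : path n ≡ a (suc na)
        visit = proj₂ (path-visits (suc na))

        deep : na < depthT N (a (suc na))
        deep = ≤-trans (height-pumped na) (height≤depth-plug (pumped na) (leaf u))

    source : ∀ {x y} → TransClosure E x y → Vₐ N m₀ x
    source [ edge vx _ ] = vx
    source (edge vx _ ∷ _) = vx

    cycle⇒deep : HasCycle N m₀ → DeepInfSeq N (single N m₀)
    cycle⇒deep (_ , cycle) =
      pump⇒deep (reachable-descends (source cycle)) (path-descends cycle)

lemma6 : (N : RPN) (m₀ : Marking (RPN.np N)) →
    DeepInfSeq N (single N m₀) ⇔ HasCycle N m₀
lemma6 N m₀ = mk⇔ (deep⇒cycle N m₀) (cycle⇒deep N m₀)
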